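{- Let $\lambda:\mathbb{N}\to\{ -1,1\}$ be the Liouville function, i.e. the unique completely multiplicative function with $\lambda(p)=-1$ for every prime $p$, and let $$l:=\sum_{n\in\mathbb{N}}\left(\frac{1+\lambda(n)}{2}\right)\frac{1}{2^n}.$$ Then $l\notin\mathbb{Q}$.
   Context: $\mathbb{N}=\{1,2,3,\ldots\}$. -}

module Defs where

open import Data.Nat using (ℕ; zero; suc; _≥_)
import Data.Nat as ℕ
open import Data.Nat.Primality using (Prime)
open import Data.Integer using (ℤ; +_; -_)
import Data.Integer as ℤ
open import Data.Rational using (ℚ; _+_; _*_; _≤_; 0ℚ; 1ℚ; ½; _/_)
open import Data.Product using (_×_)
open import Relation.Binary.PropositionalEquality using (_≡_)

-- λ is the Liouville function: the (unique) completely multiplicative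
-- function ℕ⁺ → ℤ with λ(p) = -1 for every prime p.  Values at 0 are irrelevant.
record IsLiouville (lam : ℕ → ℤ) : Set where
  field
    at-one    : lam 1 ≡ + 1
    multiplicative : ∀ m n → m ≥ 1 → n ≥ 1 → lam (m ℕ.* n) ≡ lam m ℤ.* lam n
    at-prime  : ∀ p → Prime p → lam p ≡ - (+ 1)

halfPow : ℕ → ℚ
halfPow zero    = 1ℚ
halfPow (suc n) = ½ * halfPow n

term : (ℕ → ℤ) → ℕ → ℚ
term lam n = ((ℤ._+_ (+ 1) (lam n)) / 2) * halfPow n

partialSum : (ℕ → ℤ) → ℕ → ℚ
partialSum lam zero    = 0ℚ
partialSum lam (suc N) = partialSum lam N + term lam (suc N)

-- A rational r equals the real number Σ_{n≥1} term n.
-- Since every term lies in [0, 2^{-n}], the tail after N is in [0, 2^{-N}],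
-- so the series' value is the unique point of the nested intervals
-- [S_N, S_N + 2^{-N}]; r equals it iff r lies in all of them.
SumEquals : (ℕ → ℤ) → ℚ → Set
SumEquals lam r = ∀ N → (partialSum lam N ≤ r) × (r ≤ partialSum lam N + halfPow N)

{-# OPTIONS --safe #-}
-- Put d n = (1 + λ n) / 2 ∈ {0, 1}, so that l = Σ d n 2⁻ⁿ.  If l = p / q, the scaled
-- remainders z N = q 2ᴺ⁺¹ (l - Σ_{n ≤ N} d n 2⁻ⁿ) are integers in [0, 2q] with
-- z (N + 1) = 2 z N - 2q d (N + 1).  The state z N determines d (N + 1) unless z N = q,
-- and from there the digits are constant; so by pigeonhole the digits are eventually
-- periodic, say with period T beyond i.  But λ (2n) = - λ n gives d (2m) ≠ d m, while
-- for m = (i + 1) T periodicity gives d (2m) = d (m + (i + 1) T) = d m.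
module Submission where

open import Defs
open import Data.Nat using (ℕ; zero; suc)
import Data.Nat.Base as ℕ
open import Data.Integer using (ℤ)
open import Data.Rational using (ℚ)
open import Data.Product using (∃; _,_)
open import Relation.Nullary using (¬_)

module Periodicity where
  open import Data.Bool.Base using (Bool; true; false; not; if_then_else_)
  open import Data.Bool.Properties using (not-¬)
  open import Data.Fin.Base using (Fin; toℕ; fromℕ<)
  open import Data.Fin.Properties using (pigeonhole; fromℕ<-injective)
  open import Data.Nat.Base
  open import Data.Nat.Properties
  open import Data.Product using (∃₂; _×_; _,_; proj₁; proj₂)
  open import Relation.Binary.PropositionalEquality
  open import Relation.Nullary using (contradiction)

  EventuallyPeriodic : {A : Set} → (ℕ → A) → Set
  EventuallyPeriodic f = ∃₂ λ i T → 1 ≤ T × (∀ m → i < m → f m ≡ f (m + T))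

  module _ {A : Set} {f : ℕ → A} {i T : ℕ} (period : ∀ m → i < m → f m ≡ f (m + T)) where

    period-iterate : ∀ t m → i < m → f m ≡ f (m + t * T)
    period-iterate zero    m i<m = cong f (sym (+-identityʳ m))
    period-iterate (suc t) m i<m = begin
      f m                 ≡⟨ period-iterate t m i<m ⟩
      f (m + t * T)       ≡⟨ period (m + t * T) (≤-trans i<m (m≤m+n m (t * T))) ⟩
      f (m + t * T + T)   ≡⟨ cong f (trans (+-assoc m (t * T) T) (cong (m +_) (+-comm (t * T) T))) ⟩
      f (m + suc t * T)   ∎
      where open ≡-Reasoning

  eventuallyConstant⇒eventuallyPeriodic : {A : Set} {f : ℕ → A} {b : A} (N : ℕ) →
    (∀ m → N < m → f m ≡ b) → EventuallyPeriodic f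
  eventuallyConstant⇒eventuallyPeriodic N const =
    N , 1 , ≤-refl , λ m N<m → trans (const m N<m) (sym (const (m + 1) (≤-trans N<m (m≤m+n m 1))))

  negatedAtDoubles⇒¬eventuallyPeriodic : (f : ℕ → Bool) →
    (∀ n → 1 ≤ n → f (2 * n) ≡ not (f n)) → ¬ EventuallyPeriodic f
  negatedAtDoubles⇒¬eventuallyPeriodic f flip (i , T , 1≤T , period) =
    not-¬ (sym f-m≡f-2m) (trans (cong f 2m≡m+m) (flip m 1≤m))
    where
      m = suc i * T
      i<m : i < m
      i<m = m≤m*n (suc i) T {{>-nonZero 1≤T}}
      1≤m : 1 ≤ m
      1≤m = ≤-trans (s≤s z≤n) i<m
      2m≡m+m : m + m ≡ 2 * m
      2m≡m+m = cong (m +_) (sym (+-identityʳ m))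
      f-m≡f-2m : f m ≡ f (m + m)
      f-m≡f-2m = period-iterate period (suc i) m i<m

  absorbing⇒eventuallyConstant : {S A : Set} (s : ℕ → S) (f : ℕ → A) {c : S} {b : A} →
    (∀ N → s N ≡ c → s (suc N) ≡ c × f (suc N) ≡ b) →
    ∀ {N} → s N ≡ c → ∀ m → N < m → f m ≡ b
  absorbing⇒eventuallyConstant s f {c} absorb {N} sN≡c (suc m) (s≤s N≤m) =
    proj₂ (absorb m (stays (≤⇒≤′ N≤m)))
    where
      stays : ∀ {m} → N ≤′ m → s m ≡ c
      stays ≤′-refl          = sN≡c
      stays (≤′-step N≤′m) = proj₁ (absorb _ (stays N≤′m))

  module _ {S A : Set} (s : ℕ → S) (f : ℕ → A)
    (deterministic : ∀ a b → s a ≡ s b → s (suc a) ≡ s (suc b) × f (suc a) ≡ f (suc b)) where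

    repeatedState⇒eventuallyPeriodic : ∀ {i j} → i < j → s i ≡ s j → EventuallyPeriodic f
    repeatedState⇒eventuallyPeriodic {i} {j} i<j sᵢ≡sⱼ = i , T , m<n⇒0<n∸m i<j , period
      where
        T = j ∸ i
        same-orbit : ∀ k → s (k + i) ≡ s (k + i + T)
        same-orbit zero    = trans sᵢ≡sⱼ (cong s (sym (m+[n∸m]≡n (<⇒≤ i<j))))
        same-orbit (suc k) = proj₁ (deterministic _ _ (same-orbit k))
        period : ∀ m → i < m → f m ≡ f (m + T)
        period (suc m) (s≤s i≤m) rewrite sym (m∸n+n≡m i≤m) =
          proj₂ (deterministic _ _ (same-orbit (m ∸ i)))

  bounded⇒repeats : (s : ℕ → ℕ) (B : ℕ) → (∀ n → s n ≤ B) → ∃₂ λ i j → i < j × s i ≡ s j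
  bounded⇒repeats s B s≤B
    with pigeonhole ≤-refl (λ (k : Fin (2 + B)) → fromℕ< (s≤s (s≤B (toℕ k))))
  ... | i , j , i<j , same = toℕ i , toℕ j , i<j , fromℕ<-injective _ _ _ _ same

  module RemainderDynamics (q : ℕ) .{{_ : NonZero q}} (d : ℕ → Bool) (z : ℕ → ℕ)
    (z≤2q : ∀ N → z N ≤ 2 * q)
    (z-step : ∀ N → z (suc N) + (if d (suc N) then 2 * q else 0) ≡ 2 * z N) where

    private
      weight : Bool → ℕ
      weight b = if b then 2 * q else 0

      double : ∀ x → 2 * x ≡ x + x
      double x = cong (x +_) (+-identityʳ x)

      2q>0 : 2 * q > 0
      2q>0 = >-nonZero⁻¹ (2 * q) {{m*n≢0 2 q}}

    z≡0⇒absorbing : ∀ N → z N ≡ 0 → z (suc N) ≡ 0 × d (suc N) ≡ false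
    z≡0⇒absorbing N zN≡0 with d (suc N) | z-step N
    ... | false | step = trans (sym (+-identityʳ _)) (trans step (cong (2 *_) zN≡0)) , refl
    ... | true  | step =
      contradiction (m+n≡0⇒n≡0 (z (suc N)) (trans step (cong (2 *_) zN≡0))) (n>0⇒n≢0 2q>0)

    z≡2q⇒absorbing : ∀ N → z N ≡ 2 * q → z (suc N) ≡ 2 * q × d (suc N) ≡ true
    z≡2q⇒absorbing N zN≡2q with d (suc N) | z-step N
    ... | true  | step =
      +-cancelʳ-≡ _ _ _ (trans step (trans (cong (2 *_) zN≡2q) (double (2 * q)))) , refl
    ... | false | step = contradiction too-large (<⇒≱ (m<m+n (2 * q) 2q>0))
      where
        too-large : 2 * q + 2 * q ≤ 2 * q
        too-large = subst (_≤ 2 * q)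
          (trans (sym (+-identityʳ _)) (trans step (trans (cong (2 *_) zN≡2q) (double (2 * q)))))
          (z≤2q (suc N))

    z≡q⇒eventuallyPeriodic : ∀ N → z N ≡ q → EventuallyPeriodic d
    z≡q⇒eventuallyPeriodic N zN≡q with d (suc N) | z-step N
    ... | false | step = eventuallyConstant⇒eventuallyPeriodic (suc N)
      (absorbing⇒eventuallyConstant z d z≡2q⇒absorbing
        (trans (sym (+-identityʳ _)) (trans step (cong (2 *_) zN≡q))))
    ... | true  | step = eventuallyConstant⇒eventuallyPeriodic (suc N)
      (absorbing⇒eventuallyConstant z d z≡0⇒absorbing
        (+-cancelʳ-≡ _ _ 0 (trans step (cong (2 *_) zN≡q))))

    mixed-digits⇒z≡q : ∀ {a b} → z a ≡ z b →
      z (suc a) + 0 ≡ 2 * z a → z (suc b) + 2 * q ≡ 2 * z b → z a ≡ q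
    mixed-digits⇒z≡q {a} {b} za≡zb stepa stepb = ≤-antisym (*-cancelˡ-≤ 2 below) (*-cancelˡ-≤ 2 above)
      where
        below : 2 * z a ≤ 2 * q
        below = subst (_≤ 2 * q) (trans (sym (+-identityʳ _)) stepa) (z≤2q (suc a))
        above : 2 * q ≤ 2 * z a
        above = subst (2 * q ≤_) (trans stepb (cong (2 *_) (sym za≡zb))) (m≤n+m (2 * q) (z (suc b)))

    digit-determined : ∀ a b → z a ≡ z b → z a ≢ q → d (suc a) ≡ d (suc b)
    digit-determined a b za≡zb za≢q with d (suc a) | z-step a | d (suc b) | z-step b
    ... | false | _     | false | _     = refl
    ... | true  | _     | true  | _     = refl
    ... | false | stepa | true  | stepb = contradiction (mixed-digits⇒z≡q za≡zb stepa stepb) za≢q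
    ... | true  | stepa | false | stepb =
      contradiction (trans za≡zb (mixed-digits⇒z≡q (sym za≡zb) stepb stepa)) za≢q

    step-determined : ∀ a b → z a ≡ z b → z a ≢ q → z (suc a) ≡ z (suc b) × d (suc a) ≡ d (suc b)
    step-determined a b za≡zb za≢q = +-cancelʳ-≡ (weight (d (suc b))) _ _ same-total , same-digit
      where
        open ≡-Reasoning
        same-digit : d (suc a) ≡ d (suc b)
        same-digit = digit-determined a b za≡zb za≢q
        same-total : z (suc a) + weight (d (suc b)) ≡ z (suc b) + weight (d (suc b))
        same-total = begin
          z (suc a) + weight (d (suc b))  ≡⟨ cong (λ e → z (suc a) + weight e) same-digit ⟨
          z (suc a) + weight (d (suc a))  ≡⟨ z-step a ⟩
          2 * z a                         ≡⟨ cong (2 *_) za≡zb ⟩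
          2 * z b                         ≡⟨ z-step b ⟨
          z (suc b) + weight (d (suc b))  ∎

    -- Whether z ever visits q is not decidable, hence the double negation.
    ¬¬eventuallyPeriodic : ¬ ¬ EventuallyPeriodic d
    ¬¬eventuallyPeriodic aperiodic with bounded⇒repeats z (2 * q) z≤2q
    ... | i , j , i<j , zi≡zj =
      aperiodic (repeatedState⇒eventuallyPeriodic z d deterministic i<j zi≡zj)
      where
        deterministic : ∀ a b → z a ≡ z b → z (suc a) ≡ z (suc b) × d (suc a) ≡ d (suc b)
        deterministic a b za≡zb =
          step-determined a b za≡zb (λ za≡q → aperiodic (z≡q⇒eventuallyPeriodic a za≡q))

open Periodicity

module Liouville where
  open import Data.Bool.Base using (Bool; true; false; not)
  open import Data.Nat.Base
  open import Data.Nat.Properties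
  open import Data.Nat.Induction using (<-rec)
  open import Data.Nat.Primality using (Prime; prime?; ¬prime⇒composite; composite; prime[2])
  open import Data.Nat.Divisibility using (divides)
  open import Data.Integer.Base as ℤ using (+_; -_; 1ℤ; -1ℤ)
  open import Data.Integer.Properties using (-1*i≡-i)
  open import Data.Sum using (_⊎_; inj₁; inj₂)
  open import Relation.Binary.PropositionalEquality
  open import Relation.Nullary using (yes; no)

  primeInduction : (P : ℕ → Set) → P 1 → (∀ p → Prime p → P p) →
    (∀ a b → 1 ≤ a → 1 ≤ b → P a → P b → P (a * b)) → ∀ n → 1 ≤ n → P n
  primeInduction P P1 Pprime P* = <-rec (λ n → 1 ≤ n → P n) step
    where
      step : ∀ n → (∀ {m} → m < n → 1 ≤ m → P m) → 1 ≤ n → P n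
      step 1 _ _ = P1
      step n@(2+ _) rec _ with prime? n
      ... | yes n-prime = Pprime n n-prime
      ... | no n-composite with ¬prime⇒composite n-composite
      ... | composite {d} d<n (divides c@(suc _) n≡cd) =
        subst P (sym n≡cd) (P* c d z<s d≥1 (rec c<n z<s) (rec d<n d≥1))
        where
          d≥1 : 1 ≤ d
          d≥1 = <⇒≤ (nonTrivial⇒n>1 d)
          c<n : c < n
          c<n = subst (c <_) (sym n≡cd) (m<m*n c d (nonTrivial⇒n>1 d))

  IsUnit : ℤ → Set
  IsUnit x = x ≡ 1ℤ ⊎ x ≡ -1ℤ

  isUnit-* : ∀ {x y} → IsUnit x → IsUnit y → IsUnit (x ℤ.* y)
  isUnit-* (inj₁ refl) (inj₁ refl) = inj₁ refl
  isUnit-* (inj₁ refl) (inj₂ refl) = inj₂ refl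
  isUnit-* (inj₂ refl) (inj₁ refl) = inj₂ refl
  isUnit-* (inj₂ refl) (inj₂ refl) = inj₁ refl

  module _ {lam : ℕ → ℤ} (L : IsLiouville lam) where
    open IsLiouville L

    liouville-isUnit : ∀ n → 1 ≤ n → IsUnit (lam n)
    liouville-isUnit = primeInduction (λ n → IsUnit (lam n))
      (inj₁ at-one)
      (λ p p-prime → inj₂ (at-prime p p-prime))
      (λ a b 1≤a 1≤b ua ub → subst IsUnit (sym (multiplicative a b 1≤a 1≤b)) (isUnit-* ua ub))

    liouville-double : ∀ n → 1 ≤ n → lam (2 * n) ≡ - lam n
    liouville-double n 1≤n = begin
      lam (2 * n)       ≡⟨ multiplicative 2 n (s≤s z≤n) 1≤n ⟩
      lam 2 ℤ.* lam n   ≡⟨ cong (ℤ._* lam n) (at-prime 2 prime[2]) ⟩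
      -1ℤ ℤ.* lam n     ≡⟨ -1*i≡-i (lam n) ⟩
      - lam n           ∎
      where open ≡-Reasoning

  digit : ℤ → Bool
  digit (+ 1) = true
  digit _     = false

  digit-neg : ∀ {x} → IsUnit x → digit (- x) ≡ not (digit x)
  digit-neg (inj₁ refl) = refl
  digit-neg (inj₂ refl) = refl

  liouvilleDigits-¬eventuallyPeriodic : ∀ {lam} → IsLiouville lam →
    ¬ EventuallyPeriodic (λ n → digit (lam n))
  liouvilleDigits-¬eventuallyPeriodic {lam} L = negatedAtDoubles⇒¬eventuallyPeriodic (λ n → digit (lam n))
    λ n 1≤n → trans (cong digit (liouville-double L n 1≤n)) (digit-neg (liouville-isUnit L n 1≤n))

open Liouville

module Rationals where
  import Data.Nat.Properties as ℕ
  open import Data.Integer.Base as ℤ using (+_; +[1+_]; -[1+_])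
  import Data.Integer.Properties as ℤ
  open import Data.Integer.Tactic.RingSolver using (solve-∀)
  open import Data.Rational.Base
  open import Data.Rational.Literals using (fromℤ)
  open import Data.Rational.Properties
  open import Data.Rational.Unnormalised.Base using (*≡*)
  import Data.Rational.Unnormalised.Properties as ℚᵘ
  open import Relation.Binary.PropositionalEquality

  fromℤ-neg : ∀ a → fromℤ (ℤ.- a) ≡ - fromℤ a
  fromℤ-neg (+ 0)      = refl
  fromℤ-neg +[1+ _ ]   = refl
  fromℤ-neg -[1+ _ ]   = refl

  fromℤ-+ : ∀ a b → fromℤ (a ℤ.+ b) ≡ fromℤ a + fromℤ b
  fromℤ-+ a b =
    toℚᵘ-injective (ℚᵘ.≃-sym (ℚᵘ.≃-trans (toℚᵘ-homo-+ (fromℤ a) (fromℤ b)) (*≡* (eq a b))))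
    where
      eq : ∀ a b → (a ℤ.* + 1 ℤ.+ b ℤ.* + 1) ℤ.* + 1 ≡ (a ℤ.+ b) ℤ.* + 1
      eq = solve-∀

  fromℤ-- : ∀ a b → fromℤ (a ℤ.- b) ≡ fromℤ a - fromℤ b
  fromℤ-- a b = trans (fromℤ-+ a (ℤ.- b)) (cong (λ c → fromℤ a + c) (fromℤ-neg b))

  fromℤ-* : ∀ a b → fromℤ (a ℤ.* b) ≡ fromℤ a * fromℤ b
  fromℤ-* a b = toℚᵘ-injective (ℚᵘ.≃-sym (toℚᵘ-homo-* (fromℤ a) (fromℤ b)))

  halfPow-pos : ∀ n → Positive (halfPow n)
  halfPow-pos zero    = _
  halfPow-pos (suc n) = pos*pos⇒pos ½ (halfPow n) {{halfPow-pos n}}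

  fromℤ-cancel-≤ : ∀ {a b} → fromℤ a ≤ fromℤ b → a ℤ.≤ b
  fromℤ-cancel-≤ {a} {b} a≤b = subst₂ ℤ._≤_ (ℤ.*-identityʳ a) (ℤ.*-identityʳ b) (drop-*≤* a≤b)

  ↧*p≡↥p : ∀ p → fromℤ (↧ p) * p ≡ fromℤ (↥ p)
  ↧*p≡↥p p@(mkℚ n _ _) = toℚᵘ-injective (ℚᵘ.≃-trans (toℚᵘ-homo-* (fromℤ (↧ p)) p) (*≡* eq))
    where
      eq : (↧ p ℤ.* n) ℤ.* + 1 ≡ n ℤ.* + (1 ℕ.* ↧ₙ p)
      eq = trans (ℤ.*-identityʳ _)
             (trans (ℤ.*-comm (↧ p) n) (cong (λ k → n ℤ.* + k) (sym (ℕ.*-identityˡ (↧ₙ p)))))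

open Rationals

module BinaryExpansion {lam : ℕ → ℤ} (units : ∀ n → 1 ℕ.≤ n → IsUnit (lam n))
                       (r : ℚ) (r-sum : SumEquals lam r) where
  open import Data.Bool.Base using (Bool; if_then_else_)
  open import Data.Integer.Base as ℤ using (+_; 0ℤ; 1ℤ)
  import Data.Integer.Properties as ℤ
  open import Data.Integer.Tactic.RingSolver using (solve-∀)
  open import Data.Product using (_×_; proj₁; proj₂)
  open import Data.Rational.Base
  open import Data.Rational.Literals using (fromℤ)
  open import Data.Rational.Properties
  open import Data.Rational.Solver using (module +-*-Solver)
  open import Data.Sum using (inj₁; inj₂)
  open import Relation.Binary.PropositionalEquality
  open +-*-Solver
  open ≡-Reasoning

  q : ℕ
  q = ↧ₙ r

  Q : ℚ
  Q = fromℤ (↧ r)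

  weight : Bool → ℕ
  weight b = if b then 2 ℕ.* q else 0

  Z : ℕ → ℤ
  Z zero    = + 2 ℤ.* ↥ r
  Z (suc N) = + 2 ℤ.* Z N ℤ.- + weight (digit (lam (suc N)))

  private
    two : ℚ
    two = fromℤ (+ 2)

  Q*h≡2q*½h : ∀ h → Q * h ≡ fromℤ (+ (2 ℕ.* q)) * (½ * h)
  Q*h≡2q*½h h = begin
    Q * h
      ≡⟨ solve 2 (λ Q h → Q :* h := (con two :* Q) :* (con ½ :* h)) refl Q h ⟩
    two * Q * (½ * h)
      ≡⟨ cong (_* (½ * h)) (trans (cong fromℤ (ℤ.pos-* 2 q)) (fromℤ-* (+ 2) (↧ r))) ⟨
    fromℤ (+ (2 ℕ.* q)) * (½ * h)
      ∎

  Q*digitTerm : ∀ {x} → IsUnit x → ∀ h →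
    Q * ((1ℤ ℤ.+ x) / 2 * h) ≡ fromℤ (+ weight (digit x)) * (½ * h)
  Q*digitTerm (inj₁ refl) h = trans (cong (Q *_) (*-identityˡ h)) (Q*h≡2q*½h h)
  Q*digitTerm (inj₂ refl) h =
    solve 2 (λ Q h → Q :* (con 0ℚ :* h) := con 0ℚ :* (con ½ :* h)) refl Q h

  Z-remainder : ∀ N → fromℤ (Z N) * halfPow (suc N) ≡ Q * (r - partialSum lam N)
  Z-remainder zero = begin
    fromℤ (+ 2 ℤ.* ↥ r) * (½ * 1ℚ)  ≡⟨ cong (_* (½ * 1ℚ)) (fromℤ-* (+ 2) (↥ r)) ⟩
    two * fromℤ (↥ r) * (½ * 1ℚ)    ≡⟨ solve 1 (λ a → con two :* a :* (con ½ :* con 1ℚ) := a)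
                                               refl (fromℤ (↥ r)) ⟩
    fromℤ (↥ r)                     ≡⟨ ↧*p≡↥p r ⟨
    Q * r                           ≡⟨ solve 2 (λ Q r → Q :* r := Q :* (r :- con 0ℚ)) refl Q r ⟩
    Q * (r - 0ℚ)                    ∎
  Z-remainder (suc N) = begin
    fromℤ (+ 2 ℤ.* Z N ℤ.- + w) * (½ * h)
      ≡⟨ cong (_* (½ * h)) fromℤ-Z ⟩
    (two * fromℤ (Z N) - W) * (½ * h)
      ≡⟨ solve 3 (λ z W h → (con two :* z :- W) :* (con ½ :* h) := z :* h :- W :* (con ½ :* h))
                 refl (fromℤ (Z N)) W h ⟩
    fromℤ (Z N) * h - W * (½ * h)
      ≡⟨ cong₂ _-_ (Z-remainder N) (sym (Q*digitTerm (units (suc N) (ℕ.s≤s ℕ.z≤n)) h)) ⟩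
    Q * (r - S) - Q * t
      ≡⟨ solve 4 (λ Q r S t → Q :* (r :- S) :- Q :* t := Q :* (r :- (S :+ t))) refl Q r S t ⟩
    Q * (r - (S + t))
      ∎
    where
      w = weight (digit (lam (suc N)))
      W = fromℤ (+ w)
      h = halfPow (suc N)
      S = partialSum lam N
      t = term lam (suc N)
      fromℤ-Z : fromℤ (+ 2 ℤ.* Z N ℤ.- + w) ≡ two * fromℤ (Z N) - W
      fromℤ-Z = trans (fromℤ-- (+ 2 ℤ.* Z N) (+ w)) (cong (_- W) (fromℤ-* (+ 2) (Z N)))

  remainder-bounds : ∀ N → 0ℚ ≤ r - partialSum lam N × r - partialSum lam N ≤ halfPow N
  remainder-bounds N = lower , upper
    where
      S = partialSum lam N
      lower : 0ℚ ≤ r - S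
      lower = subst (_≤ r - S) (+-inverseʳ S) (+-monoˡ-≤ (- S) (proj₁ (r-sum N)))
      upper : r - S ≤ halfPow N
      upper = subst (r - S ≤_) (solve 2 (λ S h → (S :+ h) :- S := h) refl S (halfPow N))
                (+-monoˡ-≤ (- S) (proj₂ (r-sum N)))

  Z-bounds : ∀ N → 0ℤ ℤ.≤ Z N × Z N ℤ.≤ + (2 ℕ.* q)
  Z-bounds N = fromℤ-cancel-≤ (*-cancelʳ-≤-pos h {{halfPow-pos (suc N)}} lower)
             , fromℤ-cancel-≤ (*-cancelʳ-≤-pos h {{halfPow-pos (suc N)}} upper)
    where
      h = halfPow (suc N)
      lower : fromℤ 0ℤ * h ≤ fromℤ (Z N) * h
      lower = subst₂ _≤_ (trans (*-zeroʳ Q) (sym (*-zeroˡ h))) (sym (Z-remainder N))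
                (*-monoˡ-≤-nonNeg Q (proj₁ (remainder-bounds N)))
      upper : fromℤ (Z N) * h ≤ fromℤ (+ (2 ℕ.* q)) * h
      upper = subst₂ _≤_ (sym (Z-remainder N)) (Q*h≡2q*½h (halfPow N))
                (*-monoˡ-≤-nonNeg Q (proj₂ (remainder-bounds N)))

  z : ℕ → ℕ
  z N = ℤ.∣ Z N ∣

  +z≡Z : ∀ N → + z N ≡ Z N
  +z≡Z N = ℤ.0≤i⇒+∣i∣≡i (proj₁ (Z-bounds N))

  z≤2q : ∀ N → z N ℕ.≤ 2 ℕ.* q
  z≤2q N = ℤ.drop‿+≤+ (subst (ℤ._≤ + (2 ℕ.* q)) (sym (+z≡Z N)) (proj₂ (Z-bounds N)))

  z-step : ∀ N → z (suc N) ℕ.+ weight (digit (lam (suc N))) ≡ 2 ℕ.* z N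
  z-step N = ℤ.+-injective (begin
    + (z (suc N) ℕ.+ w)  ≡⟨ ℤ.pos-+ (z (suc N)) w ⟩
    + z (suc N) ℤ.+ + w  ≡⟨ cong (ℤ._+ + w) (+z≡Z (suc N)) ⟩
    Z (suc N) ℤ.+ + w    ≡⟨ cancel (+ 2 ℤ.* Z N) (+ w) ⟩
    + 2 ℤ.* Z N          ≡⟨ cong (+ 2 ℤ.*_) (+z≡Z N) ⟨
    + 2 ℤ.* + z N        ≡⟨ ℤ.pos-* 2 (z N) ⟨
    + (2 ℕ.* z N)        ∎)
    where
      w = weight (digit (lam (suc N)))
      cancel : ∀ a b → a ℤ.- b ℤ.+ b ≡ a
      cancel = solve-∀

  ¬¬eventuallyPeriodic : ¬ ¬ EventuallyPeriodic (λ n → digit (lam n))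
  ¬¬eventuallyPeriodic =
    RemainderDynamics.¬¬eventuallyPeriodic q (λ n → digit (lam n)) z z≤2q z-step

mainTheorem1 : (lam : ℕ → ℤ) → IsLiouville lam → ¬ (∃ λ (r : ℚ) → SumEquals lam r)
mainTheorem1 lam L (r , r-sum) =
  BinaryExpansion.¬¬eventuallyPeriodic (liouville-isUnit L) r r-sum
    (liouvilleDigits-¬eventuallyPeriodic L)
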